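{- Let $p$ be a prime and $0\leq \ell < p$. Then \[S_\ell^{*0} - S_\ell^* = (-1)^\ell.\]
   Context: For $u\in\mathbb{F}_p$, $S_\ell^*(u)=\{S\subseteq \mathbb{F}_p^* \mid \#S=\ell,~\sum_{s\in S} s = u\}$, where $\mathbb{F}_p^*=\mathbb{F}_p\setminus\{0\}$. Write $S_\ell^{*0}:=\#S_\ell^*(0)$ and $S_\ell^*:=\#S_\ell^*(1)$ (the value $\#S_\ell^*(u)$ is the same for every $u\in\mathbb{F}_p^*$). -}

module Defs where

open import Data.Nat using (ℕ; zero; suc; _+_; _%_; NonZero)
open import Data.Nat.Primality using (Prime)
open import Data.Bool using (Bool; true; false; if_then_else_; _∧_)
open import Data.Fin using (Fin; toℕ)
open import Data.Fin.Subset using (Subset; ∣_∣)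
open import Data.Vec using (Vec; []; _∷_; tabulate; lookup)
open import Data.List using (List; []; _∷_; map; _++_; length; filterᵇ; allFin)
open import Data.Nat.ListAction using (sum)
import Data.Nat as ℕ

allVecs : (n : ℕ) → List (Vec Bool n)
allVecs zero = [] ∷ []
allVecs (suc n) = map (true ∷_) (allVecs n) ++ map (false ∷_) (allVecs n)

subsetSum : {n : ℕ} → Subset n → ℕ
subsetSum {n} S = sum (map (λ i → if lookup S i then toℕ i else 0) (allFin n))

-- Whether the subset avoids 0, i.e. S ⊆ F_p^* when n = p.
avoidsZero : {n : ℕ} → Subset n → Bool
avoidsZero [] = true
avoidsZero (b ∷ _) = Data.Bool.not b

-- F_p is modelled as Fin p (residues 0..p-1), with addition mod p;
-- the target u is given as a natural number, read mod p.
-- #S_ℓ^*(u) = number of S ⊆ F_p^* with #S = ℓ and Σ_{s∈S} s = u in F_p.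
Sstar : (p : ℕ) .{{_ : NonZero p}} → (ℓ : ℕ) → (u : ℕ) → ℕ
Sstar p ℓ u = length (filterᵇ ok (allVecs p))
  where
  ok : Subset p → Bool
  ok S = avoidsZero S ∧ (∣ S ∣ ℕ.≡ᵇ ℓ) ∧ ((subsetSum S % p) ℕ.≡ᵇ (u % p))

-- Let S_ℓ(u) count the ℓ-subsets of F_p (now 0 is allowed) with sum u. Splitting on whether
-- 0 ∈ S gives S_{ℓ+1}(u) = S_ℓ^*(u) + S_{ℓ+1}^*(u). Translating a subset by 1 adds ℓ to its
-- sum, so for 0 < ℓ < p, where ℓ is invertible mod p, S_ℓ(u) does not depend on u. Hence
-- S_ℓ^{*0} − S_ℓ^* changes sign from each ℓ to the next, and it is 1 for ℓ = 0.
module Submission where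

open import Defs
open import Data.Nat using (ℕ; _<_)
open import Data.Nat.Primality using (Prime; prime⇒nonZero)
open import Data.Integer using (ℤ; +_; -_; _-_; _^_)
open import Relation.Binary.PropositionalEquality using (_≡_)

open import Data.Nat using (zero; suc; _+_; _*_; _%_; _≡ᵇ_; _≟_; NonZero)
open import Data.Nat.Properties
  using (+-assoc; +-comm; +-suc; +-identityʳ; *-suc; <⇒≤; +-commutativeSemigroup)
open import Algebra.Properties.CommutativeSemigroup +-commutativeSemigroup
  using (interchange; xy∙z≈xz∙y)
open import Data.Nat.DivMod using (%-distribˡ-+; [m+n]%n≡m%n; [m+kn]%n≡m%n; m*n%n≡0)
open import Data.Nat.GCD using (module Bézout)
open import Data.Nat.Coprimality using (Coprime; coprime-Bézout; prime⇒coprime)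
open import Data.Nat.ListAction using (sum)
open import Data.Integer using (_⊖_)
open import Data.Integer.Properties using (m-n≡m⊖n; +-cancelˡ-⊖; ⊖-swap; -1*i≡-i)
open import Data.Bool using (Bool; true; false; if_then_else_; _∧_; T; T?)
open import Data.Fin using (toℕ)
open import Data.Fin.Subset using (Subset; ∣_∣; ⊥)
open import Data.Vec using (Vec; []; _∷_; _∷ʳ_; lookup)
open import Data.List using (List; []; _∷_; _++_; length; filterᵇ; map; tabulate)
open import Data.List.Properties using (length-++; filter-++; filter-≐; map-tabulate; tabulate-cong)
open import Function using (_∘_; _⇔_; mk⇔)
open import Data.Product using (_,_)
open import Relation.Unary using (_≐_)
open import Relation.Nullary using (Dec; yes; no; does)
open import Relation.Nullary.Decidable using (does-⇔)
open import Relation.Binary.PropositionalEquality using (refl; sym; trans; cong; cong₂; subst)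
open Relation.Binary.PropositionalEquality.≡-Reasoning

does-∧-subst : ∀ {A : Set} {x y : A} (x≟y : Dec (x ≡ y)) (f : A → Bool) →
  does x≟y ∧ f x ≡ does x≟y ∧ f y
does-∧-subst (yes refl) f = refl
does-∧-subst (no _)     f = refl

+-congʳ-% : ∀ a b c d .{{_ : NonZero d}} → a % d ≡ b % d → (a + c) % d ≡ (b + c) % d
+-congʳ-% a b c d a≡b = begin
  (a + c) % d           ≡⟨ %-distribˡ-+ a c d ⟩
  (a % d + c % d) % d   ≡⟨ cong (λ x → (x + c % d) % d) a≡b ⟩
  (b % d + c % d) % d   ≡⟨ %-distribˡ-+ b c d ⟨
  (b + c) % d           ∎

+-cancelʳ-% : ∀ a b c n → (a + c) % suc n ≡ (b + c) % suc n → a % suc n ≡ b % suc n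
+-cancelʳ-% a b c n a+c≡b+c = begin
  a % suc n                 ≡⟨ [m+kn]%n≡m%n a c (suc n) ⟨
  (a + c * suc n) % suc n   ≡⟨ cong (_% suc n) (regroup a) ⟩
  (a + c + c * n) % suc n   ≡⟨ +-congʳ-% (a + c) (b + c) (c * n) (suc n) a+c≡b+c ⟩
  (b + c + c * n) % suc n   ≡⟨ cong (_% suc n) (regroup b) ⟨
  (b + c * suc n) % suc n   ≡⟨ [m+kn]%n≡m%n b c (suc n) ⟩
  b % suc n                 ∎
  where
  regroup : ∀ x → x + c * suc n ≡ x + c + c * n
  regroup x = trans (cong (λ m → x + m) (*-suc c n)) (sym (+-assoc x c (c * n)))

difference-flip : ∀ a b c d → a + b ≡ c + d → + b - + d ≡ - (+ a - + c)
difference-flip a b c d a+b≡c+d = begin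
  + b - + d           ≡⟨ m-n≡m⊖n b d ⟩
  b ⊖ d               ≡⟨ +-cancelˡ-⊖ a b d ⟨
  (a + b) ⊖ (a + d)   ≡⟨ cong (_⊖ (a + d)) a+b≡c+d ⟩
  (c + d) ⊖ (a + d)   ≡⟨ cong₂ _⊖_ (+-comm c d) (+-comm a d) ⟩
  (d + c) ⊖ (d + a)   ≡⟨ +-cancelˡ-⊖ d c a ⟩
  c ⊖ a               ≡⟨ ⊖-swap c a ⟩
  - (a ⊖ c)           ≡⟨ cong -_ (m-n≡m⊖n a c) ⟨
  - (+ a - + c)       ∎

count : (n : ℕ) → (Subset n → Bool) → ℕ
count n P = length (filterᵇ P (allVecs n))

count-cong : ∀ {n} {P Q : Subset n → Bool} → (∀ S → P S ≡ Q S) → count n P ≡ count n Q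
count-cong {n} {P} {Q} P≗Q = cong length (filter-≐ (T? ∘ P) (T? ∘ Q) P≐Q (allVecs n))
  where
  P≐Q : (T ∘ P) ≐ (T ∘ Q)
  P≐Q = (λ {S} → subst T (P≗Q S)) , (λ {S} → subst T (sym (P≗Q S)))

length-filterᵇ-map : ∀ {A B : Set} (P : B → Bool) (f : A → B) (xs : List A) →
  length (filterᵇ P (map f xs)) ≡ length (filterᵇ (P ∘ f) xs)
length-filterᵇ-map P f []       = refl
length-filterᵇ-map P f (x ∷ xs) with P (f x)
... | true  = cong suc (length-filterᵇ-map P f xs)
... | false = length-filterᵇ-map P f xs

count-∷ : ∀ n (P : Subset (suc n) → Bool) →
  count (suc n) P ≡ count n (P ∘ (true ∷_)) + count n (P ∘ (false ∷_))
count-∷ n P = begin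
  length (filterᵇ P (map (true ∷_) Ss ++ map (false ∷_) Ss))
    ≡⟨ cong length (filter-++ (T? ∘ P) (map (true ∷_) Ss) _) ⟩
  length (filterᵇ P (map (true ∷_) Ss) ++ filterᵇ P (map (false ∷_) Ss))
    ≡⟨ length-++ (filterᵇ P (map (true ∷_) Ss)) ⟩
  length (filterᵇ P (map (true ∷_) Ss)) + length (filterᵇ P (map (false ∷_) Ss))
    ≡⟨ cong₂ _+_ (length-filterᵇ-map P (true ∷_) Ss) (length-filterᵇ-map P (false ∷_) Ss) ⟩
  count n (P ∘ (true ∷_)) + count n (P ∘ (false ∷_)) ∎
  where Ss = allVecs n

count-∷ʳ : ∀ n (P : Subset (suc n) → Bool) →
  count (suc n) P ≡ count n (P ∘ (_∷ʳ true)) + count n (P ∘ (_∷ʳ false))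
count-∷ʳ zero    P =
  trans (count-∷ zero P) (cong₂ _+_ (singleton true) (singleton false))
  where
  singleton : ∀ b → count 0 (P ∘ (b ∷_)) ≡ count 0 (P ∘ (_∷ʳ b))
  singleton b = count-cong {P = P ∘ (b ∷_)} {P ∘ (_∷ʳ b)} λ { [] → refl }
count-∷ʳ (suc n) P = begin
  count (suc (suc n)) P
    ≡⟨ count-∷ (suc n) P ⟩
  count (suc n) (P ∘ (true ∷_)) + count (suc n) (P ∘ (false ∷_))
    ≡⟨ cong₂ _+_ (count-∷ʳ n (P ∘ (true ∷_))) (count-∷ʳ n (P ∘ (false ∷_))) ⟩
  (# true true + # true false) + (# false true + # false false)
    ≡⟨ interchange (# true true) (# true false) (# false true) (# false false) ⟩
  (# true true + # false true) + (# true false + # false false)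
    ≡⟨ cong₂ _+_ (count-∷ n (P ∘ (_∷ʳ true))) (count-∷ n (P ∘ (_∷ʳ false))) ⟨
  count (suc n) (P ∘ (_∷ʳ true)) + count (suc n) (P ∘ (_∷ʳ false)) ∎
  where
  # : Bool → Bool → ℕ
  # first last = count n (λ S → P (first ∷ (S ∷ʳ last)))

count-false : ∀ n → count n (λ _ → false) ≡ 0
count-false zero    = refl
count-false (suc n) = trans (count-∷ n _) (cong₂ _+_ (count-false n) (count-false n))

count-empty : ∀ n (R : Subset n → Bool) →
  count n (λ S → (∣ S ∣ ≡ᵇ 0) ∧ R S) ≡ (if R ⊥ then 1 else 0)
count-empty zero    R with R []
... | true  = refl
... | false = refl
count-empty (suc n) R =
  trans (count-∷ n _) (cong₂ _+_ (count-false n) (count-empty n (R ∘ (false ∷_))))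

-- As a subset of ℤ/p, rotate S is the translate S − 1.
rotate : ∀ {A : Set} {n} → Vec A (suc n) → Vec A (suc n)
rotate (x ∷ xs) = xs ∷ʳ x

count-rotate : ∀ n (P : Subset (suc n) → Bool) → count (suc n) (P ∘ rotate) ≡ count (suc n) P
count-rotate n P = trans (count-∷ n (P ∘ rotate)) (sym (count-∷ʳ n P))

∣∷ʳ∣ : ∀ {n} (S : Subset n) b → ∣ S ∷ʳ b ∣ ≡ ∣ b ∷ S ∣
∣∷ʳ∣ []            b     = refl
∣∷ʳ∣ (false ∷ S)   b     = ∣∷ʳ∣ S b
∣∷ʳ∣ (true  ∷ S)   true  = cong suc (∣∷ʳ∣ S true)
∣∷ʳ∣ (true  ∷ S)   false = cong suc (∣∷ʳ∣ S false)

∣rotate∣ : ∀ {n} (S : Subset (suc n)) → ∣ rotate S ∣ ≡ ∣ S ∣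
∣rotate∣ (b ∷ S) = ∣∷ʳ∣ S b

subsetSumFrom : ∀ {n} → ℕ → Subset n → ℕ
subsetSumFrom k []      = 0
subsetSumFrom k (b ∷ S) = (if b then k else 0) + subsetSumFrom (suc k) S

sum-tabulate-subset : ∀ {n} k (S : Subset n) →
  sum (tabulate (λ i → if lookup S i then k + toℕ i else 0)) ≡ subsetSumFrom k S
sum-tabulate-subset k []      = refl
sum-tabulate-subset k (b ∷ S) = cong₂ _+_
  (cong (λ m → if b then m else 0) (+-identityʳ k))
  (trans (cong sum (tabulate-cong λ i → cong (λ m → if lookup S i then m else 0) (+-suc k (toℕ i))))
         (sum-tabulate-subset (suc k) S))

subsetSum≡subsetSumFrom0 : ∀ {n} (S : Subset n) → subsetSum S ≡ subsetSumFrom 0 S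
subsetSum≡subsetSumFrom0 S =
  trans (cong sum (map-tabulate (λ i → i) (λ i → if lookup S i then toℕ i else 0)))
        (sum-tabulate-subset 0 S)

subsetSum-insert-zero : ∀ {n} (S : Subset n) → subsetSum (true ∷ S) ≡ subsetSum (false ∷ S)
subsetSum-insert-zero S =
  trans (subsetSum≡subsetSumFrom0 (true ∷ S)) (sym (subsetSum≡subsetSumFrom0 (false ∷ S)))

subsetSumFrom-⊥ : ∀ n k → subsetSumFrom k (⊥ {n}) ≡ 0
subsetSumFrom-⊥ zero    k = refl
subsetSumFrom-⊥ (suc n) k = subsetSumFrom-⊥ n (suc k)

subsetSumFrom-suc : ∀ {n} k (S : Subset n) → subsetSumFrom (suc k) S ≡ subsetSumFrom k S + ∣ S ∣
subsetSumFrom-suc k []          = refl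
subsetSumFrom-suc k (false ∷ S) = subsetSumFrom-suc (suc k) S
subsetSumFrom-suc k (true ∷ S)  = begin
  suc k + subsetSumFrom (suc (suc k)) S   ≡⟨ cong (λ m → suc k + m) (subsetSumFrom-suc (suc k) S) ⟩
  suc (k + (X + ∣ S ∣))                   ≡⟨ cong suc (+-assoc k X ∣ S ∣) ⟨
  suc (k + X + ∣ S ∣)                     ≡⟨ +-suc (k + X) ∣ S ∣ ⟨
  k + X + suc ∣ S ∣                       ∎
  where X = subsetSumFrom (suc k) S

subsetSumFrom-∷ʳ : ∀ {n} k (S : Subset n) b →
  subsetSumFrom k (S ∷ʳ b) ≡ subsetSumFrom k S + (if b then k + n else 0)
subsetSumFrom-∷ʳ k []      true  = refl
subsetSumFrom-∷ʳ k []      false = refl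
subsetSumFrom-∷ʳ {suc n} k (c ∷ S) b = begin
  c₀ + subsetSumFrom (suc k) (S ∷ʳ b)
    ≡⟨ cong (λ m → c₀ + m) (subsetSumFrom-∷ʳ (suc k) S b) ⟩
  c₀ + (subsetSumFrom (suc k) S + (if b then suc k + n else 0))
    ≡⟨ +-assoc c₀ _ _ ⟨
  c₀ + subsetSumFrom (suc k) S + (if b then suc k + n else 0)
    ≡⟨ cong (λ m → c₀ + subsetSumFrom (suc k) S + (if b then m else 0)) (+-suc k n) ⟨
  c₀ + subsetSumFrom (suc k) S + (if b then k + suc n else 0) ∎
  where c₀ = if c then k else 0

-- The element 0 of S wraps around to p − 1, losing p from the sum.
subsetSumFrom-rotate : ∀ {n} b (S : Subset n) →
  subsetSumFrom 0 (rotate (b ∷ S)) + ∣ b ∷ S ∣ ≡ subsetSumFrom 0 (b ∷ S) + (if b then suc n else 0)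
subsetSumFrom-rotate {n} true S = begin
  subsetSumFrom 0 (S ∷ʳ true) + suc ∣ S ∣   ≡⟨ cong (_+ suc ∣ S ∣) (subsetSumFrom-∷ʳ 0 S true) ⟩
  subsetSumFrom 0 S + n + suc ∣ S ∣         ≡⟨ +-suc _ ∣ S ∣ ⟩
  suc (subsetSumFrom 0 S + n + ∣ S ∣)       ≡⟨ cong suc (xy∙z≈xz∙y (subsetSumFrom 0 S) n ∣ S ∣) ⟩
  suc (subsetSumFrom 0 S + ∣ S ∣ + n)       ≡⟨ +-suc _ n ⟨
  subsetSumFrom 0 S + ∣ S ∣ + suc n         ≡⟨ cong (_+ suc n) (subsetSumFrom-suc 0 S) ⟨
  subsetSumFrom 1 S + suc n                 ∎
subsetSumFrom-rotate false S = begin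
  subsetSumFrom 0 (S ∷ʳ false) + ∣ S ∣   ≡⟨ cong (_+ ∣ S ∣) (subsetSumFrom-∷ʳ 0 S false) ⟩
  subsetSumFrom 0 S + 0 + ∣ S ∣          ≡⟨ cong (_+ ∣ S ∣) (+-identityʳ _) ⟩
  subsetSumFrom 0 S + ∣ S ∣              ≡⟨ subsetSumFrom-suc 0 S ⟨
  subsetSumFrom 1 S                      ≡⟨ +-identityʳ _ ⟨
  subsetSumFrom 1 S + 0                  ∎

subsetSum-rotate : ∀ {n} (S : Subset (suc n)) →
  (subsetSum (rotate S) + ∣ S ∣) % suc n ≡ subsetSum S % suc n
subsetSum-rotate {n} (b ∷ S) = begin
  (subsetSum (rotate (b ∷ S)) + ∣ b ∷ S ∣) % suc n
    ≡⟨ cong (λ m → (m + ∣ b ∷ S ∣) % suc n) (subsetSum≡subsetSumFrom0 (rotate (b ∷ S))) ⟩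
  (subsetSumFrom 0 (rotate (b ∷ S)) + ∣ b ∷ S ∣) % suc n
    ≡⟨ cong (_% suc n) (subsetSumFrom-rotate b S) ⟩
  (subsetSumFrom 0 (b ∷ S) + (if b then suc n else 0)) % suc n
    ≡⟨ drop-multiple b (subsetSumFrom 0 (b ∷ S)) ⟩
  subsetSumFrom 0 (b ∷ S) % suc n
    ≡⟨ cong (_% suc n) (subsetSum≡subsetSumFrom0 (b ∷ S)) ⟨
  subsetSum (b ∷ S) % suc n ∎
  where
  drop-multiple : ∀ c m → (m + (if c then suc n else 0)) % suc n ≡ m % suc n
  drop-multiple true  m = [m+n]%n≡m%n m (suc n)
  drop-multiple false m = cong (_% suc n) (+-identityʳ m)

hasSizeAndSum : (p : ℕ) .{{_ : NonZero p}} → ℕ → ℕ → Subset p → Bool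
hasSizeAndSum p ℓ u S = (∣ S ∣ ≡ᵇ ℓ) ∧ (subsetSum S % p ≡ᵇ u % p)

Sall : (p : ℕ) .{{_ : NonZero p}} → ℕ → ℕ → ℕ
Sall p ℓ u = count p (hasSizeAndSum p ℓ u)

Sall-cong-% : ∀ p .{{_ : NonZero p}} ℓ u v → u % p ≡ v % p → Sall p ℓ u ≡ Sall p ℓ v
Sall-cong-% p ℓ u v u≡v = cong (λ r → count p (λ S → (∣ S ∣ ≡ᵇ ℓ) ∧ (subsetSum S % p ≡ᵇ r))) u≡v

Sall-shift : ∀ n ℓ u → Sall (suc n) ℓ u ≡ Sall (suc n) ℓ (u + ℓ)
Sall-shift n ℓ u = trans (sym (count-rotate n _)) (count-cong translate)
  where
  p = suc n
  translate : ∀ S → hasSizeAndSum p ℓ u (rotate S) ≡ hasSizeAndSum p ℓ (u + ℓ) S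
  translate S = begin
    (∣ rotate S ∣ ≡ᵇ ℓ) ∧ (subsetSum (rotate S) % p ≡ᵇ u % p)
      ≡⟨ cong (λ m → (m ≡ᵇ ℓ) ∧ (subsetSum (rotate S) % p ≡ᵇ u % p)) (∣rotate∣ S) ⟩
    (∣ S ∣ ≡ᵇ ℓ) ∧ (subsetSum (rotate S) % p ≡ᵇ u % p)
      ≡⟨ cong ((∣ S ∣ ≡ᵇ ℓ) ∧_) (does-⇔ shifted (_ ≟ _) (_ ≟ _)) ⟩
    (∣ S ∣ ≡ᵇ ℓ) ∧ (subsetSum S % p ≡ᵇ (u + ∣ S ∣) % p)
      ≡⟨ does-∧-subst (∣ S ∣ ≟ ℓ) (λ m → subsetSum S % p ≡ᵇ (u + m) % p) ⟩
    (∣ S ∣ ≡ᵇ ℓ) ∧ (subsetSum S % p ≡ᵇ (u + ℓ) % p) ∎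
    where
    shifted : subsetSum (rotate S) % p ≡ u % p ⇔ subsetSum S % p ≡ (u + ∣ S ∣) % p
    shifted = mk⇔
      (λ eq → trans (sym (subsetSum-rotate S)) (+-congʳ-% (subsetSum (rotate S)) u ∣ S ∣ p eq))
      (λ eq → +-cancelʳ-% (subsetSum (rotate S)) u ∣ S ∣ n (trans (subsetSum-rotate S) eq))

Sall-shift-by : ∀ n ℓ u k → Sall (suc n) ℓ u ≡ Sall (suc n) ℓ (u + k * ℓ)
Sall-shift-by n ℓ u zero    = cong (Sall (suc n) ℓ) (sym (+-identityʳ u))
Sall-shift-by n ℓ u (suc k) = begin
  Sall (suc n) ℓ u                   ≡⟨ Sall-shift n ℓ u ⟩
  Sall (suc n) ℓ (u + ℓ)             ≡⟨ Sall-shift-by n ℓ (u + ℓ) k ⟩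
  Sall (suc n) ℓ (u + ℓ + k * ℓ)     ≡⟨ cong (Sall (suc n) ℓ) (+-assoc u ℓ (k * ℓ)) ⟩
  Sall (suc n) ℓ (u + (ℓ + k * ℓ))   ∎

Sall-independent : ∀ n ℓ → Coprime (suc n) ℓ → Sall (suc n) ℓ 0 ≡ Sall (suc n) ℓ 1
-- Bézout gives y with y ℓ ≡ ±1 (mod p); shifting by y ℓ moves the target sum between 0 and 1.
Sall-independent n ℓ coprime with coprime-Bézout coprime
... | Bézout.+- x y 1+yℓ≡xp = begin
  Sall (suc n) ℓ 0             ≡⟨ Sall-cong-% (suc n) ℓ 0 (x * suc n) (sym (m*n%n≡0 x (suc n))) ⟩
  Sall (suc n) ℓ (x * suc n)   ≡⟨ cong (Sall (suc n) ℓ) 1+yℓ≡xp ⟨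
  Sall (suc n) ℓ (1 + y * ℓ)   ≡⟨ Sall-shift-by n ℓ 1 y ⟨
  Sall (suc n) ℓ 1             ∎
... | Bézout.-+ x y 1+xp≡yℓ = begin
  Sall (suc n) ℓ 0                 ≡⟨ Sall-shift-by n ℓ 0 y ⟩
  Sall (suc n) ℓ (y * ℓ)           ≡⟨ cong (Sall (suc n) ℓ) 1+xp≡yℓ ⟨
  Sall (suc n) ℓ (1 + x * suc n)
    ≡⟨ Sall-cong-% (suc n) ℓ (1 + x * suc n) 1 ([m+kn]%n≡m%n 1 x (suc n)) ⟩
  Sall (suc n) ℓ 1                 ∎

Sstar-∷ : ∀ n ℓ u → Sstar (suc n) ℓ u ≡ count n (λ S → hasSizeAndSum (suc n) ℓ u (false ∷ S))
Sstar-∷ n ℓ u = trans (count-∷ n _) (cong (_+ count n without0) (count-false n))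
  where
  without0 : Subset n → Bool
  without0 S = hasSizeAndSum (suc n) ℓ u (false ∷ S)

Sall-split : ∀ n ℓ u → Sall (suc n) (suc ℓ) u ≡ Sstar (suc n) ℓ u + Sstar (suc n) (suc ℓ) u
Sall-split n ℓ u = begin
  Sall (suc n) (suc ℓ) u
    ≡⟨ count-∷ n (hasSizeAndSum (suc n) (suc ℓ) u) ⟩
  count n (with0 (suc ℓ)) + count n (without0 (suc ℓ))
    ≡⟨ cong (_+ count n (without0 (suc ℓ))) (count-cong with0≗without0) ⟩
  count n (without0 ℓ) + count n (without0 (suc ℓ))
    ≡⟨ cong₂ _+_ (Sstar-∷ n ℓ u) (Sstar-∷ n (suc ℓ) u) ⟨
  Sstar (suc n) ℓ u + Sstar (suc n) (suc ℓ) u ∎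
  where
  with0 without0 : ℕ → Subset n → Bool
  with0    m S = hasSizeAndSum (suc n) m u (true ∷ S)
  without0 m S = hasSizeAndSum (suc n) m u (false ∷ S)
  with0≗without0 : ∀ S → with0 (suc ℓ) S ≡ without0 ℓ S
  with0≗without0 S = cong (λ m → (∣ S ∣ ≡ᵇ ℓ) ∧ (m % suc n ≡ᵇ u % suc n)) (subsetSum-insert-zero S)

Sstar-empty : ∀ n u → Sstar (suc n) 0 u ≡ (if 0 ≡ᵇ u % suc n then 1 else 0)
Sstar-empty n u = begin
  Sstar (suc n) 0 u
    ≡⟨ Sstar-∷ n 0 u ⟩
  count n (λ S → (∣ S ∣ ≡ᵇ 0) ∧ sumIs (false ∷ S))
    ≡⟨ count-empty n (sumIs ∘ (false ∷_)) ⟩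
  (if subsetSum (false ∷ ⊥ {n}) % suc n ≡ᵇ u % suc n then 1 else 0)
    ≡⟨ cong (λ m → if m % suc n ≡ᵇ u % suc n then 1 else 0)
            (trans (subsetSum≡subsetSumFrom0 (⊥ {suc n})) (subsetSumFrom-⊥ (suc n) 0)) ⟩
  (if 0 ≡ᵇ u % suc n then 1 else 0) ∎
  where
  sumIs : Subset (suc n) → Bool
  sumIs S = subsetSum S % suc n ≡ᵇ u % suc n

proposition5 : (p : ℕ) → (pr : Prime p) → (ℓ : ℕ) → ℓ < p →
    (+ Sstar p {{prime⇒nonZero pr}} ℓ 0) - (+ Sstar p {{prime⇒nonZero pr}} ℓ 1) ≡ (- (+ 1)) ^ ℓ
proposition5 0 () _ _
proposition5 1 () _ _
proposition5 p@(suc (suc n)) pr zero _ =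
  cong₂ (λ a b → + a - + b) (Sstar-empty (suc n) 0) (Sstar-empty (suc n) 1)
proposition5 p@(suc (suc n)) pr (suc ℓ) 1+ℓ<p = begin
  + S⁰ (suc ℓ) - + S¹ (suc ℓ)   ≡⟨ difference-flip (S⁰ ℓ) (S⁰ (suc ℓ)) (S¹ ℓ) (S¹ (suc ℓ)) balance ⟩
  - (+ S⁰ ℓ - + S¹ ℓ)           ≡⟨ cong -_ (proposition5 p pr ℓ (<⇒≤ 1+ℓ<p)) ⟩
  - (- (+ 1)) ^ ℓ               ≡⟨ -1*i≡-i _ ⟨
  (- (+ 1)) ^ suc ℓ             ∎
  where
  S⁰ S¹ : ℕ → ℕ
  S⁰ m = Sstar p m 0
  S¹ m = Sstar p m 1
  balance : S⁰ ℓ + S⁰ (suc ℓ) ≡ S¹ ℓ + S¹ (suc ℓ)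
  balance = begin
    S⁰ ℓ + S⁰ (suc ℓ)   ≡⟨ Sall-split (suc n) ℓ 0 ⟨
    Sall p (suc ℓ) 0    ≡⟨ Sall-independent (suc n) (suc ℓ) (prime⇒coprime pr 1+ℓ<p) ⟩
    Sall p (suc ℓ) 1    ≡⟨ Sall-split (suc n) ℓ 1 ⟩
    S¹ ℓ + S¹ (suc ℓ)   ∎
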